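{- Let $k\ge1$ be an integer and let $G$ be a connected graph with $n=|V(G)|$ vertices that has a matching of size $k$ (so $n\ge 2k$). Let $\mathcal{P}_k(G)$ be the convex hull of all $x\in\{0,1\}^{V(G)\times[k]}$ satisfying (a) $\sum_{v\in V(G)} x_{v,i}\le \sum_{v\in V(G)} x_{v,i+1}$ for all $i\in[k-1]$; (b) $\sum_{i\in[k]} x_{v,i}\le 1$ for all $v\in V(G)$; (c) $x_{u,i}+x_{v,i}-\sum_{z\in S}x_{z,i}\le 1$ for every pair of distinct non-adjacent vertices $u,v$, every minimal $(u,v)$-separator $S$, and every $i\in[k]$. Then $\mathcal{P}_k(G)$ is full-dimensional, i.e. $\dim\mathcal{P}_k(G)=kn$.
   Context: $[k]=\{1,\dots,k\}$. For non-adjacent vertices $u,v$, a $(u,v)$-separator is a set $S\subseteq V(G)\setminus\{u,v\}$ such that $u,v$ are in different components of $G-S$; minimal means inclusion-minimal. -}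

module Defs where

open import Data.Nat as ℕ using (ℕ; zero; suc)
import Data.Fin
open Data.Fin using (Fin; toℕ)
open import Data.Bool using (Bool; true; false; if_then_else_)
open import Data.Product using (Σ; _×_; _,_; ∃)
open import Relation.Binary.PropositionalEquality using (_≡_; _≢_)
open import Relation.Nullary using (¬_)
open import Data.Rational as ℚ using (ℚ; 0ℚ; 1ℚ)

record Graph (n : ℕ) : Set₁ where
  field
    Adj     : Fin n → Fin n → Set
    sym     : ∀ {u v} → Adj u v → Adj v u
    irrefl  : ∀ {u} → ¬ Adj u u
open Graph public

VSet : ℕ → Set
VSet n = Fin n → Bool

data WalkAvoid {n : ℕ} (G : Graph n) (S : VSet n) : Fin n → Fin n → Set where
  here : ∀ {u} → S u ≡ false → WalkAvoid G S u u
  step : ∀ {u w v} → S u ≡ false → Adj G u w → WalkAvoid G S w v → WalkAvoid G S u v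

emptySet : ∀ {n} → VSet n
emptySet _ = false

Connected : ∀ {n} → Graph n → Set
Connected G = ∀ u v → WalkAvoid G emptySet u v

HasMatchingOfSize : ∀ {n} → Graph n → ℕ → Set
HasMatchingOfSize {n} G k =
  Σ (Fin k → Fin n × Fin n) λ e →
    (∀ j → let (a , b) = e j in Adj G a b) ×
    (∀ j j' → j ≢ j' →
       let (a , b) = e j ; (c , d) = e j' in
       a ≢ c × a ≢ d × b ≢ c × b ≢ d)

IsSeparator : ∀ {n} → Graph n → Fin n → Fin n → VSet n → Set
IsSeparator G u v S = S u ≡ false × S v ≡ false × ¬ WalkAvoid G S u v

_⊆ₛ_ : ∀ {n} → VSet n → VSet n → Set
T ⊆ₛ S = ∀ z → T z ≡ true → S z ≡ true

IsMinimalSeparator : ∀ {n} → Graph n → Fin n → Fin n → VSet n → Set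
IsMinimalSeparator G u v S =
  IsSeparator G u v S × (∀ T → T ⊆ₛ S → IsSeparator G u v T → ∀ z → T z ≡ S z)

sumℕ : ∀ {m} → (Fin m → ℕ) → ℕ
sumℕ {zero}  f = 0
sumℕ {suc m} f = f Data.Fin.zero ℕ.+ sumℕ (λ i → f (Data.Fin.suc i))

sumℚ : ∀ {m} → (Fin m → ℚ) → ℚ
sumℚ {zero}  f = 0ℚ
sumℚ {suc m} f = f Data.Fin.zero ℚ.+ sumℚ (λ i → f (Data.Fin.suc i))

b2n : Bool → ℕ
b2n true  = 1
b2n false = 0

b2q : Bool → ℚ
b2q true  = 1ℚ
b2q false = 0ℚ

Point01 : ℕ → ℕ → Set
Point01 n k = Fin n → Fin k → Bool

colSum : ∀ {n k} → Point01 n k → Fin k → ℕ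
colSum x i = sumℕ (λ v → b2n (x v i))

Feasible : ∀ {n k} → Graph n → Point01 n k → Set
Feasible {n} {k} G x =
  (∀ (i j : Fin k) → toℕ j ≡ suc (toℕ i) → colSum x i ℕ.≤ colSum x j) ×
  (∀ v → sumℕ (λ i → b2n (x v i)) ℕ.≤ 1) ×
  -- (c) x_{u,i} + x_{v,i} - Σ_{z∈S} x_{z,i} ≤ 1 (rearranged over ℕ)
  (∀ u v → u ≢ v → ¬ Adj G u v → ∀ S → IsMinimalSeparator G u v S → ∀ i →
     b2n (x u i) ℕ.+ b2n (x v i)
       ℕ.≤ 1 ℕ.+ sumℕ (λ z → if S z then b2n (x z i) else 0))

PointQ : ℕ → ℕ → Set
PointQ n k = Fin n → Fin k → ℚ

embed : ∀ {n k} → Point01 n k → PointQ n k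
embed x v i = b2q (x v i)

InP : ∀ {n k} → Graph n → PointQ n k → Set
InP {n} {k} G y =
  Σ ℕ λ m → Σ (Fin m → Point01 n k) λ pts → Σ (Fin m → ℚ) λ μ →
    (∀ j → Feasible G (pts j)) ×
    (∀ j → 0ℚ ℚ.≤ μ j) ×
    (sumℚ μ ≡ 1ℚ) ×
    (∀ v i → y v i ≡ sumℚ (λ j → μ j ℚ.* embed (pts j) v i))

AffinelyIndependent : ∀ {n k m} → (Fin m → PointQ n k) → Set
AffinelyIndependent {n} {k} {m} p =
  ∀ (λ' : Fin m → ℚ) →
    sumℚ λ' ≡ 0ℚ →
    (∀ v i → sumℚ (λ j → λ' j ℚ.* p j v i) ≡ 0ℚ) →
    ∀ j → λ' j ≡ 0ℚ

-- dim P = kn (P ⊆ ℚ^{n·k}, so dim ≤ kn always): P contains kn+1 affinely independent points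
FullDimensional : ∀ {n} → Graph n → (k : ℕ) → Set
FullDimensional {n} G k =
  Σ (Fin (suc (k ℕ.* n)) → PointQ n k) λ p →
    (∀ j → InP G (p j)) × AffinelyIndependent p

-- A matching of size k ≥ 1 gives n ≥ 2k > k vertices. Then for every colour i and vertex v
-- there is a feasible "staircase" point: colours below i are unused, v gets colour i, and each
-- colour c > i goes to a vertex of its own different from v. Every colour class of these
-- points (and of the zero point) has at most one vertex. Ordered by colour, the staircase for
-- (i, v) is the first to be nonzero at the coordinate (v, i), so the kn staircases are
-- linearly independent, and together with the origin they are kn + 1 affinely independent
-- points of P_k(G).
module Submission where

open import Defs hiding (sym)
open import Data.Nat as ℕ using (ℕ; zero; suc; _≤_; _<_; z≤n; s≤s)
import Data.Nat.Properties as ℕ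
open import Data.Fin as Fin using (Fin; toℕ; punchIn; inject≤; combine; remQuot; splitAt)
import Data.Fin.Properties as Fin
open import Data.Maybe using (Maybe; just; nothing)
open import Data.Maybe.Properties using (just-injective; ≡-dec)
open import Data.Vec.Functional using (_∷_)
open import Data.Bool using (Bool; true; false; if_then_else_)
open import Data.Product using (_×_; _,_; proj₁; proj₂; ∃; uncurry)
open import Data.Sum using (_⊎_; inj₁; inj₂; [_,_])
open import Data.Empty using (⊥; ⊥-elim)
open import Function using (_∘_; Injective)
open import Relation.Nullary using (¬_; yes; no; isYes)
open import Relation.Binary using (tri<; tri≈; tri>)
open import Relation.Binary.PropositionalEquality
  using (_≡_; _≢_; refl; sym; trans; cong; cong₂; subst; module ≡-Reasoning)
open import Data.Rational as ℚ using (ℚ; 0ℚ; 1ℚ)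
import Data.Rational.Properties as ℚ

private
  variable
    m n k : ℕ

sumℕ-zero : (f : Fin m → ℕ) → (∀ j → f j ≡ 0) → sumℕ f ≡ 0
sumℕ-zero {zero}  f f≡0 = refl
sumℕ-zero {suc m} f f≡0 rewrite f≡0 Fin.zero = sumℕ-zero (f ∘ Fin.suc) (f≡0 ∘ Fin.suc)

AtMostOne : (Fin m → Bool) → Set
AtMostOne g = ∀ a b → g a ≡ true → g b ≡ true → a ≡ b

sumℕ-b2n-≤1 : (g : Fin m → Bool) → AtMostOne g → sumℕ (b2n ∘ g) ≤ 1
sumℕ-b2n-≤1 {zero}  g unique = z≤n
sumℕ-b2n-≤1 {suc m} g unique with g Fin.zero in g0
... | false = sumℕ-b2n-≤1 (g ∘ Fin.suc)
                (λ a b ga gb → Fin.suc-injective (unique (Fin.suc a) (Fin.suc b) ga gb))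
... | true = ℕ.≤-reflexive (cong suc (sumℕ-zero _ restFalse))
  where
  restFalse : ∀ j → b2n (g (Fin.suc j)) ≡ 0
  restFalse j with g (Fin.suc j) in gj
  ... | false = refl
  ... | true with () ← unique Fin.zero (Fin.suc j) g0 gj

sumℕ-b2n-≥1 : (g : Fin m → Bool) (a : Fin m) → g a ≡ true → 1 ≤ sumℕ (b2n ∘ g)
sumℕ-b2n-≥1 g Fin.zero    ga rewrite ga = s≤s z≤n
sumℕ-b2n-≥1 g (Fin.suc a) ga =
  ℕ.≤-trans (sumℕ-b2n-≥1 (g ∘ Fin.suc) a ga) (ℕ.m≤n+m _ (b2n (g Fin.zero)))

sumℚ-zero : (f : Fin m → ℚ) → (∀ j → f j ≡ 0ℚ) → sumℚ f ≡ 0ℚ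
sumℚ-zero {zero}  f f≡0 = refl
sumℚ-zero {suc m} f f≡0
  rewrite f≡0 Fin.zero | sumℚ-zero (f ∘ Fin.suc) (f≡0 ∘ Fin.suc) = refl

sumℚ-single : (f : Fin m → ℚ) (j : Fin m) → (∀ j' → j' ≢ j → f j' ≡ 0ℚ) → sumℚ f ≡ f j
sumℚ-single f Fin.zero others
  rewrite sumℚ-zero (f ∘ Fin.suc) (λ j' → others (Fin.suc j') (λ ())) = ℚ.+-identityʳ _
sumℚ-single f (Fin.suc j) others
  rewrite others Fin.zero (λ ())
        | sumℚ-single (f ∘ Fin.suc) j (λ j' j'≢j → others (Fin.suc j') (j'≢j ∘ Fin.suc-injective))
  = ℚ.+-identityˡ _

colouring : (Fin k → Maybe (Fin n)) → Point01 n k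
colouring σ u c = isYes (≡-dec Fin._≟_ (σ c) (just u))

colouring-true⇒ : ∀ (σ : Fin k → Maybe (Fin n)) {u c} → colouring σ u c ≡ true → σ c ≡ just u
colouring-true⇒ σ {u} {c} eq with ≡-dec Fin._≟_ (σ c) (just u)
... | yes σc≡u = σc≡u

colouring-true⇐ : ∀ (σ : Fin k → Maybe (Fin n)) {u c} → σ c ≡ just u → colouring σ u c ≡ true
colouring-true⇐ σ {u} {c} σc≡u with ≡-dec Fin._≟_ (σ c) (just u)
... | yes _      = refl
... | no  σc≢u = ⊥-elim (σc≢u σc≡u)

colSum-nothing : ∀ (σ : Fin k → Maybe (Fin n)) c → σ c ≡ nothing → colSum (colouring σ) c ≡ 0
colSum-nothing σ c σc≡nothing =
  sumℕ-zero _ (λ u → cong (λ m → b2n (isYes (≡-dec Fin._≟_ m (just u)))) σc≡nothing)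

colouring-column-atMostOne : ∀ (σ : Fin k → Maybe (Fin n)) c → AtMostOne (λ u → colouring σ u c)
colouring-column-atMostOne σ c u u' xu xu' =
  just-injective (trans (sym (colouring-true⇒ σ xu)) (colouring-true⇒ σ xu'))

InjectiveOnDomain : (Fin k → Maybe (Fin n)) → Set
InjectiveOnDomain σ = ∀ c c' {u} → σ c ≡ just u → σ c' ≡ just u → c ≡ c'

UpwardClosedDomain : (Fin k → Maybe (Fin n)) → Set
UpwardClosedDomain σ = ∀ c c' {u} → c Fin.≤ c' → σ c ≡ just u → ∃ λ u' → σ c' ≡ just u'

b2n-+-≤1 : ∀ a b → (a ≡ true → b ≡ true → ⊥) → b2n a ℕ.+ b2n b ≤ 1
b2n-+-≤1 true  true  both = ⊥-elim (both refl refl)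
b2n-+-≤1 true  false _    = s≤s z≤n
b2n-+-≤1 false true  _    = s≤s z≤n
b2n-+-≤1 false false _    = z≤n

colouring-feasible : (G : Graph n) (σ : Fin k → Maybe (Fin n)) →
  InjectiveOnDomain σ → UpwardClosedDomain σ → Feasible G (colouring σ)
colouring-feasible G σ injective upward = monotone , rowsAtMostOne , separators
  where
  monotone : ∀ c c' → toℕ c' ≡ suc (toℕ c) → colSum (colouring σ) c ≤ colSum (colouring σ) c'
  monotone c c' c'≡c+1 = byColour (σ c) refl
    where
    byColour : ∀ m → σ c ≡ m → colSum (colouring σ) c ≤ colSum (colouring σ) c'
    byColour nothing  σc = ℕ.≤-trans (ℕ.≤-reflexive (colSum-nothing σ c σc)) z≤n
    byColour (just u) σc
      with u' , σc' ← upward c c' (subst (toℕ c ≤_) (sym c'≡c+1) (ℕ.n≤1+n _)) σc =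
      ℕ.≤-trans (sumℕ-b2n-≤1 _ (colouring-column-atMostOne σ c))
                (sumℕ-b2n-≥1 _ u' (colouring-true⇐ σ σc'))

  rowsAtMostOne : ∀ u → sumℕ (λ c → b2n (colouring σ u c)) ≤ 1
  rowsAtMostOne u = sumℕ-b2n-≤1 _ λ c c' xc xc' →
    injective c c' (colouring-true⇒ σ xc) (colouring-true⇒ σ xc')

  separators : ∀ u v → u ≢ v → ¬ Adj G u v → ∀ S → IsMinimalSeparator G u v S → ∀ c →
    b2n (colouring σ u c) ℕ.+ b2n (colouring σ v c)
      ≤ 1 ℕ.+ sumℕ (λ z → if S z then b2n (colouring σ z c) else 0)
  separators u v u≢v _ _ _ c = ℕ.≤-trans
    (b2n-+-≤1 _ _ λ xu xv → u≢v (colouring-column-atMostOne σ c u v xu xv))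
    (ℕ.m≤m+n 1 _)

feasible⇒InP : (G : Graph n) (x : Point01 n k) → Feasible G x → InP G (embed x)
feasible⇒InP G x feasible =
  1 , (λ _ → x) , (λ _ → 1ℚ) , (λ _ → feasible) , (λ _ → ℚ.nonNegative⁻¹ 1ℚ) , refl , single
  where
  single : ∀ v i → embed x v i ≡ 1ℚ ℚ.* embed x v i ℚ.+ 0ℚ
  single v i with x v i
  ... | true  = refl
  ... | false = refl

_at_ : PointQ n k → Fin n × Fin k → ℚ
x at vi = x (proj₁ vi) (proj₂ vi)

LinearlyIndependent : (Fin m → PointQ n k) → Set
LinearlyIndependent {m} p =
  ∀ (λ' : Fin m → ℚ) → (∀ v i → sumℚ (λ j → λ' j ℚ.* p j v i) ≡ 0ℚ) → ∀ j → λ' j ≡ 0ℚ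

triangular⇒linearlyIndependent :
  (p : Fin m → PointQ n k) (rank : Fin m → ℕ) (pivot : Fin m → Fin n × Fin k) →
  (∀ j → p j at pivot j ≡ 1ℚ) →
  (∀ j j' → j' ≢ j → rank j ≤ rank j' → p j' at pivot j ≡ 0ℚ) →
  LinearlyIndependent p
triangular⇒linearlyIndependent p rank pivot diagonal offDiagonal λ' combination j =
  vanishes (suc (rank j)) j ℕ.≤-refl
  where
  vanishes : ∀ r j → rank j < r → λ' j ≡ 0ℚ
  vanishes (suc r) j (s≤s rankj≤r) = begin
    λ' j                                                  ≡⟨ sym (ℚ.*-identityʳ _) ⟩
    λ' j ℚ.* 1ℚ                                           ≡⟨ cong (λ' j ℚ.*_) (sym (diagonal j)) ⟩
    λ' j ℚ.* (p j at pivot j)                             ≡⟨ sym (sumℚ-single _ j others) ⟩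
    sumℚ (λ j' → λ' j' ℚ.* (p j' at pivot j))             ≡⟨ uncurry combination (pivot j) ⟩
    0ℚ                                                    ∎
    where
    open ≡-Reasoning
    others : ∀ j' → j' ≢ j → λ' j' ℚ.* (p j' at pivot j) ≡ 0ℚ
    others j' j'≢j with rank j' ℕ.<? rank j
    ... | yes lower = trans (cong (ℚ._* _) (vanishes r j' (ℕ.≤-trans lower rankj≤r)))
                            (ℚ.*-zeroˡ (p j' at pivot j))
    ... | no ¬lower = trans (cong (λ' j' ℚ.*_) (offDiagonal j j' j'≢j (ℕ.≮⇒≥ ¬lower)))
                            (ℚ.*-zeroʳ (λ' j'))

origin∷linearlyIndependent⇒affinelyIndependent : (p : Fin (suc m) → PointQ n k) →
  (∀ v i → p Fin.zero v i ≡ 0ℚ) → LinearlyIndependent (p ∘ Fin.suc) → AffinelyIndependent p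
origin∷linearlyIndependent⇒affinelyIndependent p origin independent λ' total combination = vanishes
  where
  λ₀ : ℚ
  λ₀ = λ' Fin.zero

  rest : ∀ v i → ℚ
  rest v i = sumℚ (λ j → λ' (Fin.suc j) ℚ.* p (Fin.suc j) v i)

  vanishesˢ : ∀ j → λ' (Fin.suc j) ≡ 0ℚ
  vanishesˢ = independent (λ' ∘ Fin.suc) λ v i → begin
    rest v i                                    ≡⟨ sym (ℚ.+-identityˡ (rest v i)) ⟩
    0ℚ ℚ.+ rest v i                             ≡⟨ cong (ℚ._+ rest v i) (sym (ℚ.*-zeroʳ λ₀)) ⟩
    λ₀ ℚ.* 0ℚ ℚ.+ rest v i                      ≡⟨ cong (λ t → λ₀ ℚ.* t ℚ.+ rest v i) (sym (origin v i)) ⟩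
    λ₀ ℚ.* p Fin.zero v i ℚ.+ rest v i          ≡⟨ combination v i ⟩
    0ℚ                                          ∎
    where open ≡-Reasoning

  vanishes : ∀ j → λ' j ≡ 0ℚ
  vanishes Fin.zero = begin
    λ₀                               ≡⟨ sym (ℚ.+-identityʳ λ₀) ⟩
    λ₀ ℚ.+ 0ℚ                        ≡⟨ cong (λ₀ ℚ.+_) (sym (sumℚ-zero _ vanishesˢ)) ⟩
    λ₀ ℚ.+ sumℚ (λ' ∘ Fin.suc)       ≡⟨ total ⟩
    0ℚ                               ∎
    where open ≡-Reasoning
  vanishes (Fin.suc j) = vanishesˢ j

module Staircase {N k : ℕ} (k≤N : k ≤ N) where

  avoiding : Fin (suc N) → Fin k → Fin (suc N)
  avoiding v c = punchIn v (inject≤ c k≤N)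

  staircase : Fin k → Fin (suc N) → Fin k → Maybe (Fin (suc N))
  staircase i v c with Fin.<-cmp c i
  ... | tri< _ _ _ = nothing
  ... | tri≈ _ _ _ = just v
  ... | tri> _ _ _ = just (avoiding v c)

  staircase-just⇒ : ∀ i v c {u} → staircase i v c ≡ just u →
    (c ≡ i × u ≡ v) ⊎ (i Fin.< c × u ≡ avoiding v c)
  staircase-just⇒ i v c eq with Fin.<-cmp c i
  ... | tri≈ _ c≡i _ = inj₁ (c≡i , sym (just-injective eq))
  ... | tri> _ _ i<c = inj₂ (i<c , sym (just-injective eq))

  staircase-≥⇒just : ∀ i v c → i Fin.≤ c → ∃ λ u → staircase i v c ≡ just u
  staircase-≥⇒just i v c i≤c with Fin.<-cmp c i
  ... | tri< c<i _ _ = ⊥-elim (ℕ.<⇒≱ c<i i≤c)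
  ... | tri≈ _ _ _   = v , refl
  ... | tri> _ _ _   = avoiding v c , refl

  staircase-diagonal : ∀ i v → staircase i v i ≡ just v
  staircase-diagonal i v with Fin.<-cmp i i
  ... | tri< i<i _ _ = ⊥-elim (Fin.<-irrefl refl i<i)
  ... | tri≈ _ _ _   = refl
  ... | tri> _ _ i<i = ⊥-elim (Fin.<-irrefl refl i<i)

  staircase-injective : ∀ i v → InjectiveOnDomain (staircase i v)
  staircase-injective i v c c' eq eq'
    with staircase-just⇒ i v c eq | staircase-just⇒ i v c' eq'
  ... | inj₁ (c≡i , _) | inj₁ (c'≡i , _) = trans c≡i (sym c'≡i)
  ... | inj₁ (_ , u≡v) | inj₂ (_ , u≡w) = ⊥-elim (Fin.punchInᵢ≢i v _ (trans (sym u≡w) u≡v))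
  ... | inj₂ (_ , u≡w) | inj₁ (_ , u≡v) = ⊥-elim (Fin.punchInᵢ≢i v _ (trans (sym u≡w) u≡v))
  ... | inj₂ (_ , u≡w) | inj₂ (_ , u≡w') =
    Fin.inject≤-injective k≤N k≤N c c' (Fin.punchIn-injective v _ _ (trans (sym u≡w) u≡w'))

  staircase-upward : ∀ i v → UpwardClosedDomain (staircase i v)
  staircase-upward i v c c' c≤c' eq with staircase-just⇒ i v c eq
  ... | inj₁ (refl , _) = staircase-≥⇒just i v c' c≤c'
  ... | inj₂ (i<c , _)  = staircase-≥⇒just i v c' (ℕ.≤-trans (ℕ.<⇒≤ i<c) c≤c')

  staircase-entry : ∀ i' v' i v → colouring (staircase i' v') v i ≡ true →
    (i' ≡ i × v' ≡ v) ⊎ i' Fin.< i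
  staircase-entry i' v' i v x≡true
    with staircase-just⇒ i' v' i (colouring-true⇒ (staircase i' v') x≡true)
  ... | inj₁ (i≡i' , v≡v') = inj₁ (sym i≡i' , sym v≡v')
  ... | inj₂ (i'<i , _)    = inj₂ i'<i

  colourOf : Fin (k ℕ.* suc N) → Fin k
  colourOf j = proj₁ (remQuot {k} (suc N) j)

  vertexOf : Fin (k ℕ.* suc N) → Fin (suc N)
  vertexOf j = proj₂ (remQuot {k} (suc N) j)

  stairsOf : Fin (k ℕ.* suc N) → Fin k → Maybe (Fin (suc N))
  stairsOf j = staircase (colourOf j) (vertexOf j)

  staircaseOf : Fin (k ℕ.* suc N) → Point01 (suc N) k
  staircaseOf j = colouring (stairsOf j)

  index-injective : ∀ j j' → colourOf j ≡ colourOf j' → vertexOf j ≡ vertexOf j' → j ≡ j'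
  index-injective j j' colours vertices = begin
    j                                   ≡⟨ sym (Fin.combine-remQuot {k} (suc N) j) ⟩
    combine (colourOf j) (vertexOf j)   ≡⟨ cong₂ combine colours vertices ⟩
    combine (colourOf j') (vertexOf j') ≡⟨ Fin.combine-remQuot {k} (suc N) j' ⟩
    j'                                  ∎
    where open ≡-Reasoning

  staircases-linearlyIndependent : LinearlyIndependent (embed ∘ staircaseOf)
  staircases-linearlyIndependent =
    triangular⇒linearlyIndependent (embed ∘ staircaseOf)
      (toℕ ∘ colourOf) (λ j → vertexOf j , colourOf j)
      (λ j → cong b2q (colouring-true⇐ (stairsOf j) (staircase-diagonal (colourOf j) (vertexOf j))))
      offDiagonal
    where
    offDiagonal : ∀ j j' → j' ≢ j → toℕ (colourOf j) ≤ toℕ (colourOf j') →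
      b2q (staircaseOf j' (vertexOf j) (colourOf j)) ≡ 0ℚ
    offDiagonal j j' j'≢j i≤i' with staircaseOf j' (vertexOf j) (colourOf j) in x≡true
    ... | false = refl
    ... | true with staircase-entry (colourOf j') (vertexOf j') (colourOf j) (vertexOf j) x≡true
    ...   | inj₁ (i'≡i , v'≡v) = ⊥-elim (j'≢j (index-injective j' j i'≡i v'≡v))
    ...   | inj₂ i'<i          = ⊥-elim (ℕ.<⇒≱ i'<i i≤i')

  points : Fin (suc (k ℕ.* suc N)) → Point01 (suc N) k
  points = colouring (λ _ → nothing) ∷ staircaseOf

  points-feasible : (G : Graph (suc N)) → ∀ j → Feasible G (points j)
  points-feasible G Fin.zero = colouring-feasible G (λ _ → nothing) (λ _ _ ()) (λ _ _ _ ())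
  points-feasible G (Fin.suc j) =
    colouring-feasible G (stairsOf j) (staircase-injective (colourOf j) (vertexOf j))
                                      (staircase-upward (colourOf j) (vertexOf j))

  fullDimensional : (G : Graph (suc N)) → FullDimensional G k
  fullDimensional G =
    embed ∘ points ,
    (λ j → feasible⇒InP G (points j) (points-feasible G j)) ,
    origin∷linearlyIndependent⇒affinelyIndependent (embed ∘ points) (λ _ _ → refl)
      staircases-linearlyIndependent

matching⇒2k≤n : (G : Graph n) → HasMatchingOfSize G k → k ℕ.+ k ≤ n
matching⇒2k≤n {n} {k} G (e , edge , disjoint) =
  Fin.injective⇒≤ (splitAt-injective ∘ endpoints-injective)
  where
  endpoints : Fin k ⊎ Fin k → Fin n
  endpoints = [ proj₁ ∘ e , proj₂ ∘ e ]

  loopless : ∀ j → proj₁ (e j) ≢ proj₂ (e j)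
  loopless j ends = irrefl G (subst (Adj G (proj₁ (e j))) (sym ends) (edge j))

  endpoints-injective : Injective _≡_ _≡_ endpoints
  endpoints-injective {inj₁ a} {inj₁ b} eq with a Fin.≟ b
  ... | yes refl = refl
  ... | no a≢b = ⊥-elim (proj₁ (disjoint a b a≢b) eq)
  endpoints-injective {inj₁ a} {inj₂ b} eq with a Fin.≟ b
  ... | yes refl = ⊥-elim (loopless a eq)
  ... | no a≢b = ⊥-elim (proj₁ (proj₂ (disjoint a b a≢b)) eq)
  endpoints-injective {inj₂ a} {inj₁ b} eq with a Fin.≟ b
  ... | yes refl = ⊥-elim (loopless a (sym eq))
  ... | no a≢b = ⊥-elim (proj₁ (proj₂ (proj₂ (disjoint a b a≢b))) eq)
  endpoints-injective {inj₂ a} {inj₂ b} eq with a Fin.≟ b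
  ... | yes refl = refl
  ... | no a≢b = ⊥-elim (proj₂ (proj₂ (proj₂ (disjoint a b a≢b))) eq)

  splitAt-injective : ∀ {j j'} → splitAt k {k} j ≡ splitAt k j' → j ≡ j'
  splitAt-injective {j} {j'} eq = begin
    j                           ≡⟨ sym (Fin.join-splitAt k k j) ⟩
    Fin.join k k (splitAt k j)  ≡⟨ cong (Fin.join k k) eq ⟩
    Fin.join k k (splitAt k j') ≡⟨ Fin.join-splitAt k k j' ⟩
    j'                          ∎
    where open ≡-Reasoning

mainTheorem4 : (k n : ℕ) → 1 ≤ k → (G : Graph n) → Connected G →
    HasMatchingOfSize G k → FullDimensional G k
mainTheorem4 k n 1≤k G _ matching with ℕ.<-≤-trans (ℕ.m<m+n k 1≤k) (matching⇒2k≤n G matching)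
mainTheorem4 k (suc N) _ G _ _ | s≤s k≤N = Staircase.fullDimensional k≤N G
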